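{- Let $m\in\mathbb Z$, $n,p\in\mathbb N$ with $m\le n$, and consider the inequality $(\mathrm{div}_{p,n})$: $((n+1)\cdot((p\cdot x-\mathtt f)\vee(\mathtt f-p\cdot x))-\mathtt f)\vee(-x)\ge 0$. The following are equivalent: (1) $\mathbf Z_m\models(\mathrm{div}_{p,n})$; (2) $\mathbf Z_m\ltimes\mathbf Z_0\models(\mathrm{div}_{p,n})$; (3) $m\le 0$ or $p$ is not a divisor of $m$.
   Context: $\mathbf Z_m$ is the ordered group of integers with constant $\mathtt f$ interpreted as $m$; $\mathbf Z_m\ltimes\mathbf Z_0$ is $\mathbb Z\times\mathbb Z$ with lexicographic order (first coordinate dominant) and $\mathtt f=\langle m,0\rangle$. $k\cdot t$ is the $k$-fold sum; $\models$ means the inequality holds under every evaluation. -}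

module Defs where

open import Data.Nat using (ℕ; zero; suc)
open import Data.Integer as ℤ using (ℤ; +_; _<?_)
open import Data.Product using (_×_; _,_)
open import Data.Sum using (_⊎_)
open import Relation.Nullary using (yes; no)
open import Relation.Binary.PropositionalEquality using (_≡_)

data Term : Set where
  var  : Term
  cf   : Term
  zro  : Term
  _⊕_  : Term → Term → Term
  neg  : Term → Term
  _∨ₜ_ : Term → Term → Term

infixl 6 _⊕_ _⊖_
infixl 5 _∨ₜ_

_⊖_ : Term → Term → Term
s ⊖ t = s ⊕ neg t

_·_ : ℕ → Term → Term
zero  · t = zro
suc k · t = t ⊕ (k · t)

infixr 7 _·_

divTerm : ℕ → ℕ → Term
divTerm p n = ((suc n · ((p · var ⊖ cf) ∨ₜ (cf ⊖ p · var))) ⊖ cf) ∨ₜ neg var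

record Structure : Set₁ where
  field
    Carrier : Set
    _≤_     : Carrier → Carrier → Set
    _+_     : Carrier → Carrier → Carrier
    -_      : Carrier → Carrier
    0#      : Carrier
    f       : Carrier
    _∨_     : Carrier → Carrier → Carrier

module _ (S : Structure) where
  open Structure S
  ⟦_⟧ : Term → Carrier → Carrier
  ⟦ var ⟧ x = x
  ⟦ cf ⟧ x = f
  ⟦ zro ⟧ x = 0#
  ⟦ s ⊕ t ⟧ x = ⟦ s ⟧ x + ⟦ t ⟧ x
  ⟦ neg t ⟧ x = - ⟦ t ⟧ x
  ⟦ s ∨ₜ t ⟧ x = ⟦ s ⟧ x ∨ ⟦ t ⟧ x

_⊨_≥0 : Structure → Term → Set
S ⊨ t ≥0 = ∀ (x : Structure.Carrier S) → Structure._≤_ S (Structure.0# S) (⟦ S ⟧ t x)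

Zm : ℤ → Structure
Zm m = record
  { Carrier = ℤ ; _≤_ = ℤ._≤_ ; _+_ = ℤ._+_ ; -_ = ℤ.-_ ; 0# = + 0
  ; f = m ; _∨_ = ℤ._⊔_ }

-- Z_m ⋉ Z_0 : ℤ × ℤ, componentwise addition, lexicographic order
-- (first coordinate dominant), f = ⟨m,0⟩
_≤lex_ : ℤ × ℤ → ℤ × ℤ → Set
(a , b) ≤lex (c , d) = (a ℤ.< c) ⊎ (a ≡ c × b ℤ.≤ d)

_∨lex_ : ℤ × ℤ → ℤ × ℤ → ℤ × ℤ
(a , b) ∨lex (c , d) with a <? c | c <? a
... | yes _ | _     = (c , d)
... | no _  | yes _ = (a , b)
... | no _  | no _  = (a , b ℤ.⊔ d)

ZmLexZ0 : ℤ → Structure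
ZmLexZ0 m = record
  { Carrier = ℤ × ℤ ; _≤_ = _≤lex_
  ; _+_ = λ { (a , b) (c , d) → (a ℤ.+ c , b ℤ.+ d) }
  ; -_ = λ { (a , b) → (ℤ.- a , ℤ.- b) }
  ; 0# = (+ 0 , + 0) ; f = (m , + 0) ; _∨_ = _∨lex_ }

-- The first coordinate of an evaluation in Z_m ⋉ Z_0 is the evaluation in Z_m, which gives
-- (2) ⇒ (1).  If m > 0 and m = p q, then at x = q the term is −m ∨ −q < 0, which gives
-- (1) ⇒ (3).  Conversely, if m ≠ 0 and (3) holds, the term is strictly positive on Z_m: for
-- x < 0 because of −x, and for x ≥ 0 because (n+1)|p x − m| exceeds m (for m > 0 the
-- distance is at least 1 since p ∤ m, and m ≤ n).  A term that is strictly positive on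
-- Z_m is positive in the lexicographic product.  For m = 0 the term is
-- ((n+1)|p x|) ∨ (−x), which is positive in every lattice-ordered group.
module Submission where

open import Defs
open import Data.Nat using (ℕ; zero; suc; z≤n; s≤s)
open import Data.Integer using (ℤ; +_; -[1+_]; _+_; _*_; _≤_; _<_; _⊔_; _-_; -_; ∣_∣; +≤+; +<+; -<+)
open import Data.Integer.Divisibility using (_∣_)
open import Data.Product using (_×_; _,_; proj₁)
open import Data.Sum using (_⊎_; inj₁; inj₂)
open import Relation.Nullary using (¬_; yes; no; contradiction)
open import Function.Bundles using (_⇔_; mk⇔)

import Data.Nat as ℕ
import Data.Nat.Properties as ℕ
open import Data.Nat.Divisibility using (divides) renaming (_∣?_ to _∣ℕ?_)
import Data.Integer as ℤ
import Data.Integer.Properties as ℤ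
open import Algebra.Properties.AbelianGroup ℤ.+-0-abelianGroup using (⁻¹-anti-homo‿-)
open import Data.Product.Relation.Binary.Lex.Strict using (×-transitive)
open import Relation.Binary.PropositionalEquality
  using (_≡_; refl; sym; trans; cong; cong₂; subst; isEquivalence; resp₂; module ≡-Reasoning)

i⊔-i≡∣i∣ : ∀ i → i ⊔ - i ≡ + ∣ i ∣
i⊔-i≡∣i∣ (+ zero)  = refl
i⊔-i≡∣i∣ (+ suc k) = refl
i⊔-i≡∣i∣ -[1+ k ]  = refl

i-j⊔j-i≡∣i-j∣ : ∀ i j → (i - j) ⊔ (j - i) ≡ + ∣ i - j ∣
i-j⊔j-i≡∣i-j∣ i j = trans (cong ((i - j) ⊔_) (sym (⁻¹-anti-homo‿- i j))) (i⊔-i≡∣i∣ (i - j))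

i<j⇒0<j-i : ∀ {i j} → i < j → + 0 < j - i
i<j⇒0<j-i {i} {j} i<j = subst (_< j - i) (ℤ.+-inverseʳ i) (ℤ.+-monoˡ-< (- i) i<j)

⟦·⟧-Zm : ∀ m k t x → ⟦ Zm m ⟧ (k · t) x ≡ + k * ⟦ Zm m ⟧ t x
⟦·⟧-Zm m zero    t x = refl
⟦·⟧-Zm m (suc k) t x = begin
  y + ⟦ Zm m ⟧ (k · t) x  ≡⟨ cong (_+_ y) (⟦·⟧-Zm m k t x) ⟩
  y + + k * y             ≡⟨ ℤ.suc-* (+ k) y ⟨
  + suc k * y             ∎
  where
  open ≡-Reasoning
  y : ℤ
  y = ⟦ Zm m ⟧ t x

⟦divTerm⟧-Zm : ∀ m n p x →
  ⟦ Zm m ⟧ (divTerm p n) x ≡ (+ (suc n ℕ.* ∣ + p * x - m ∣) - m) ⊔ - x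
⟦divTerm⟧-Zm m n p x = begin
  (⟦ Zm m ⟧ (suc n · dist) x - m) ⊔ - x
    ≡⟨ cong (λ y → (y - m) ⊔ - x) (⟦·⟧-Zm m (suc n) dist x) ⟩
  (+ suc n * ((px - m) ⊔ (m - px)) - m) ⊔ - x
    ≡⟨ cong (λ d → (+ suc n * d - m) ⊔ - x) (i-j⊔j-i≡∣i-j∣ px m) ⟩
  (+ suc n * + ∣ px - m ∣ - m) ⊔ - x
    ≡⟨ cong (λ y → (y - m) ⊔ - x) (ℤ.pos-* (suc n) ∣ px - m ∣) ⟨
  (+ (suc n ℕ.* ∣ px - m ∣) - m) ⊔ - x
    ≡⟨ cong (λ y → (+ (suc n ℕ.* ∣ y - m ∣) - m) ⊔ - x) (⟦·⟧-Zm m p var x) ⟩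
  (+ (suc n ℕ.* ∣ + p * x - m ∣) - m) ⊔ - x
    ∎
  where
  open ≡-Reasoning
  dist : Term
  dist = (p · var ⊖ cf) ∨ₜ (cf ⊖ p · var)
  px : ℤ
  px = ⟦ Zm m ⟧ (p · var) x

divTerm-Zm-negative : ∀ r n p q → suc r ≡ q ℕ.* p → ⟦ Zm (+ suc r) ⟧ (divTerm p n) (+ q) < + 0
divTerm-Zm-negative r n p (suc q) m≡qp = subst (_< + 0) (sym value≡) -<+
  where
  open ≡-Reasoning
  m : ℤ
  m = + suc r
  pq≡m : + p * + suc q ≡ m
  pq≡m = trans (sym (ℤ.pos-* p (suc q))) (cong +_ (trans (ℕ.*-comm p (suc q)) (sym m≡qp)))
  value≡ : ⟦ Zm m ⟧ (divTerm p n) (+ suc q) ≡ -[1+ r ] ⊔ -[1+ q ]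
  value≡ = begin
    ⟦ Zm m ⟧ (divTerm p n) (+ suc q)
      ≡⟨ ⟦divTerm⟧-Zm m n p (+ suc q) ⟩
    (+ (suc n ℕ.* ∣ + p * + suc q - m ∣) - m) ⊔ -[1+ q ]
      ≡⟨ cong (λ d → (+ (suc n ℕ.* ∣ d ∣) - m) ⊔ -[1+ q ]) (ℤ.i≡j⇒i-j≡0 pq≡m) ⟩
    (+ (suc n ℕ.* 0) - m) ⊔ -[1+ q ]
      ≡⟨ cong (λ k → (+ k - m) ⊔ -[1+ q ]) (ℕ.*-zeroʳ (suc n)) ⟩
    -[1+ r ] ⊔ -[1+ q ]
      ∎

divTerm-Zm-positive : ∀ m n p → (∀ j → m < + (suc n ℕ.* ∣ + p * + j - m ∣)) →
  ∀ x → + 0 < ⟦ Zm m ⟧ (divTerm p n) x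
divTerm-Zm-positive m n p below x = subst (+ 0 <_) (sym (⟦divTerm⟧-Zm m n p x)) (positive x)
  where
  positive : ∀ x → + 0 < (+ (suc n ℕ.* ∣ + p * x - m ∣) - m) ⊔ - x
  positive -[1+ k ] = ℤ.<-≤-trans (+<+ (s≤s z≤n)) (ℤ.i≤j⊔i _ (+ suc k))
  positive (+ j)    = ℤ.<-≤-trans (i<j⇒0<j-i (below j)) (ℤ.i≤i⊔j _ _)

p∤m⇒m<[1+n]*∣pj-m∣ : ∀ r n p → suc r ℕ.≤ n → ¬ (+ p ∣ + suc r) →
  ∀ j → + suc r < + (suc n ℕ.* ∣ + p * + j - + suc r ∣)
p∤m⇒m<[1+n]*∣pj-m∣ r n p r<n p∤m j =
  +<+ (ℕ.<-≤-trans (s≤s r<n) (ℕ.m≤m*n (suc n) d {{ℕ.≢-nonZero d≢0}}))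
  where
  d : ℕ
  d = ∣ + p * + j - + suc r ∣
  d≢0 : ¬ (d ≡ 0)
  d≢0 d≡0 = p∤m (divides j (sym (trans (ℕ.*-comm j p) pj≡m)))
    where
    pj≡m : p ℕ.* j ≡ suc r
    pj≡m = ℤ.+-injective (trans (ℤ.pos-* p j) (ℤ.i-j≡0⇒i≡j _ _ (ℤ.∣i∣≡0⇒i≡0 d≡0)))

Zm⊨divTerm⇒nonDividing : ∀ m n p → Zm m ⊨ divTerm p n ≥0 → m ≤ + 0 ⊎ ¬ (+ p ∣ m)
Zm⊨divTerm⇒nonDividing -[1+ r ] n p _ = inj₁ ℤ.-≤+
Zm⊨divTerm⇒nonDividing (+ zero)  n p _ = inj₁ ℤ.≤-refl
Zm⊨divTerm⇒nonDividing (+ suc r) n p valid with p ∣ℕ? suc r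
... | no p∤m               = inj₂ p∤m
... | yes (divides q m≡qp) = contradiction (valid (+ q)) (ℤ.<⇒≱ (divTerm-Zm-negative r n p q m≡qp))

-- The group operations of ZmLexZ0 m do not depend on m.
open Structure (ZmLexZ0 (+ 0)) using () renaming (_+_ to _+ₗ_; -_ to -ₗ_; 0# to 0ₗ)

≤lex-trans : ∀ {u v w} → u ≤lex v → v ≤lex w → u ≤lex w
≤lex-trans = ×-transitive {_<₂_ = _≤_} isEquivalence (resp₂ _<_) ℤ.<-trans ℤ.≤-trans

u≤lexu∨v : ∀ u v → u ≤lex (u ∨lex v)
u≤lexu∨v (a , b) (c , d) with a ℤ.<? c | c ℤ.<? a
... | yes a<c | _     = inj₁ a<c
... | no _    | yes _ = inj₂ (refl , ℤ.≤-refl)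
... | no _    | no _  = inj₂ (refl , ℤ.i≤i⊔j b d)

0≤lex-+ : ∀ {u v} → 0ₗ ≤lex u → 0ₗ ≤lex v → 0ₗ ≤lex (u +ₗ v)
0≤lex-+ (inj₁ 0<a)          (inj₁ 0<c)          = inj₁ (ℤ.+-mono-< 0<a 0<c)
0≤lex-+ (inj₁ 0<a)          (inj₂ (refl , _))   = inj₁ (ℤ.+-mono-<-≤ 0<a ℤ.≤-refl)
0≤lex-+ (inj₂ (refl , _))   (inj₁ 0<c)          = inj₁ (ℤ.+-mono-≤-< (ℤ.≤-refl {+ 0}) 0<c)
0≤lex-+ (inj₂ (refl , 0≤b)) (inj₂ (refl , 0≤d)) = inj₂ (refl , ℤ.+-mono-≤ 0≤b 0≤d)

0≤lex-∣u∣ : ∀ u → 0ₗ ≤lex (u ∨lex (-ₗ u))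
0≤lex-∣u∣ (+ zero  , b) = inj₂ (refl , subst (+ 0 ≤_) (sym (i⊔-i≡∣i∣ b)) (+≤+ z≤n))
0≤lex-∣u∣ (+ suc k , b) = inj₁ (+<+ (s≤s z≤n))
0≤lex-∣u∣ (-[1+ k ] , b) = inj₁ (+<+ (s≤s z≤n))

+ₗ-identityˡ : ∀ u → 0ₗ +ₗ u ≡ u
+ₗ-identityˡ (a , b) = cong₂ _,_ (ℤ.+-identityˡ a) (ℤ.+-identityˡ b)

+ₗ-identityʳ : ∀ u → u +ₗ 0ₗ ≡ u
+ₗ-identityʳ (a , b) = cong₂ _,_ (ℤ.+-identityʳ a) (ℤ.+-identityʳ b)

0≤lex-⟦·⟧ : ∀ m k t x → 0ₗ ≤lex ⟦ ZmLexZ0 m ⟧ t x → 0ₗ ≤lex ⟦ ZmLexZ0 m ⟧ (k · t) x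
0≤lex-⟦·⟧ m zero    t x _   = inj₂ (refl , ℤ.≤-refl)
0≤lex-⟦·⟧ m (suc k) t x 0≤t = 0≤lex-+ 0≤t (0≤lex-⟦·⟧ m k t x 0≤t)

ZmLexZ0⊨divTerm-at-0 : ∀ n p → ZmLexZ0 (+ 0) ⊨ divTerm p n ≥0
ZmLexZ0⊨divTerm-at-0 n p x =
  ≤lex-trans (subst (0ₗ ≤lex_) (sym (+ₗ-identityʳ A)) 0≤A) (u≤lexu∨v _ _)
  where
  ⟦_⟧₀ : Term → ℤ × ℤ → ℤ × ℤ
  ⟦_⟧₀ = ⟦ ZmLexZ0 (+ 0) ⟧
  dist : Term
  dist = (p · var ⊖ cf) ∨ₜ (cf ⊖ p · var)
  P A : ℤ × ℤ
  P = ⟦ p · var ⟧₀ x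
  A = ⟦ suc n · dist ⟧₀ x
  0≤dist : 0ₗ ≤lex ⟦ dist ⟧₀ x
  0≤dist = subst (0ₗ ≤lex_) (sym (cong₂ _∨lex_ (+ₗ-identityʳ P) (+ₗ-identityˡ (-ₗ P)))) (0≤lex-∣u∣ P)
  0≤A : 0ₗ ≤lex A
  0≤A = 0≤lex-⟦·⟧ (+ 0) (suc n) dist x 0≤dist

proj₁-∨lex : ∀ u v → proj₁ (u ∨lex v) ≡ proj₁ u ⊔ proj₁ v
proj₁-∨lex (a , b) (c , d) with a ℤ.<? c | c ℤ.<? a
... | yes a<c | _       = sym (ℤ.i≤j⇒i⊔j≡j (ℤ.<⇒≤ a<c))
... | no _    | yes c<a = sym (ℤ.i≥j⇒i⊔j≡i (ℤ.<⇒≤ c<a))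
... | no a≮c  | no _    = sym (ℤ.i≥j⇒i⊔j≡i (ℤ.≮⇒≥ a≮c))

proj₁-⟦⟧ : ∀ m t a b → proj₁ (⟦ ZmLexZ0 m ⟧ t (a , b)) ≡ ⟦ Zm m ⟧ t a
proj₁-⟦⟧ m var      a b = refl
proj₁-⟦⟧ m cf       a b = refl
proj₁-⟦⟧ m zro      a b = refl
proj₁-⟦⟧ m (s ⊕ t)  a b = cong₂ _+_ (proj₁-⟦⟧ m s a b) (proj₁-⟦⟧ m t a b)
proj₁-⟦⟧ m (neg t)  a b = cong -_ (proj₁-⟦⟧ m t a b)
proj₁-⟦⟧ m (s ∨ₜ t) a b =
  trans (proj₁-∨lex (⟦ ZmLexZ0 m ⟧ s (a , b)) (⟦ ZmLexZ0 m ⟧ t (a , b)))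
        (cong₂ _⊔_ (proj₁-⟦⟧ m s a b) (proj₁-⟦⟧ m t a b))

0≤lex⇒0≤proj₁ : ∀ {u} → 0ₗ ≤lex u → + 0 ≤ proj₁ u
0≤lex⇒0≤proj₁ (inj₁ 0<a)        = ℤ.<⇒≤ 0<a
0≤lex⇒0≤proj₁ (inj₂ (refl , _)) = ℤ.≤-refl

ZmLexZ0⊨⇒Zm⊨ : ∀ m t → ZmLexZ0 m ⊨ t ≥0 → Zm m ⊨ t ≥0
ZmLexZ0⊨⇒Zm⊨ m t valid a = subst (+ 0 ≤_) (proj₁-⟦⟧ m t a (+ 0)) (0≤lex⇒0≤proj₁ (valid (a , + 0)))

Zm-positive⇒ZmLexZ0⊨ : ∀ m t → (∀ a → + 0 < ⟦ Zm m ⟧ t a) → ZmLexZ0 m ⊨ t ≥0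
Zm-positive⇒ZmLexZ0⊨ m t positive (a , b) = inj₁ (subst (+ 0 <_) (sym (proj₁-⟦⟧ m t a b)) (positive a))

nonDividing⇒ZmLexZ0⊨divTerm : ∀ m n p → m ≤ + n → m ≤ + 0 ⊎ ¬ (+ p ∣ m) → ZmLexZ0 m ⊨ divTerm p n ≥0
nonDividing⇒ZmLexZ0⊨divTerm -[1+ r ] n p _ _ =
  Zm-positive⇒ZmLexZ0⊨ _ (divTerm p n) (divTerm-Zm-positive _ n p (λ _ → -<+))
nonDividing⇒ZmLexZ0⊨divTerm (+ zero)  n p _ _ = ZmLexZ0⊨divTerm-at-0 n p
nonDividing⇒ZmLexZ0⊨divTerm (+ suc r) n p _ (inj₁ (+≤+ ()))
nonDividing⇒ZmLexZ0⊨divTerm (+ suc r) n p (+≤+ r<n) (inj₂ p∤m) =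
  Zm-positive⇒ZmLexZ0⊨ _ (divTerm p n) (divTerm-Zm-positive _ n p (p∤m⇒m<[1+n]*∣pj-m∣ r n p r<n p∤m))

lemma5p2 : (m : ℤ) (n p : ℕ) → m ≤ + n →
    ((Zm m ⊨ divTerm p n ≥0) ⇔ (ZmLexZ0 m ⊨ divTerm p n ≥0))
    × ((ZmLexZ0 m ⊨ divTerm p n ≥0) ⇔ (m ≤ + 0 ⊎ ¬ (+ p ∣ m)))
lemma5p2 m n p m≤n =
  mk⇔ (λ valid → 3⇒2 (1⇒3 valid)) 2⇒1 , mk⇔ (λ valid → 1⇒3 (2⇒1 valid)) 3⇒2
  where
  1⇒3 : Zm m ⊨ divTerm p n ≥0 → m ≤ + 0 ⊎ ¬ (+ p ∣ m)
  1⇒3 = Zm⊨divTerm⇒nonDividing m n p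
  2⇒1 : ZmLexZ0 m ⊨ divTerm p n ≥0 → Zm m ⊨ divTerm p n ≥0
  2⇒1 = ZmLexZ0⊨⇒Zm⊨ m (divTerm p n)
  3⇒2 : m ≤ + 0 ⊎ ¬ (+ p ∣ m) → ZmLexZ0 m ⊨ divTerm p n ≥0
  3⇒2 = nonDividing⇒ZmLexZ0⊨divTerm m n p m≤n
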